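{- There is no simple involution of length $n>2$ that avoids the pattern $3412$.
   Context: A permutation $\pi\in S_n$ avoids a pattern $s\in S_k$ if no subsequence of $\pi$ is order-isomorphic to $s$. An involution is a permutation equal to its own inverse. An interval of $\pi\in S_n$ is a set of contiguous positions $[a,b]$ whose image $\{\pi(i):a\le i\le b\}$ is a set of contiguous integers; $\pi$ is simple if its only intervals are the empty set, singletons and $[1,n]$. -}

module Defs where

open import Data.Nat using (ℕ; suc)
open import Data.Sum using (_⊎_)
open import Data.Fin using (Fin; toℕ; _<_; _≤_)
open import Data.Fin.Permutation using (Permutation′; _⟨$⟩ʳ_)
open import Data.Product using (Σ; ∃; _×_; _,_)
open import Relation.Binary.PropositionalEquality using (_≡_)
open import Relation.Nullary using (¬_)

-- A permutation of [n] = {0,…,n-1} (0-indexed positions and values).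
Perm : ℕ → Set
Perm n = Permutation′ n

IsInvolution : ∀ {n} → Perm n → Set
IsInvolution {n} π = ∀ (i : Fin n) → π ⟨$⟩ʳ (π ⟨$⟩ʳ i) ≡ i

Contains3412 : ∀ {n} → Perm n → Set
Contains3412 {n} π =
  Σ (Fin n) λ i → Σ (Fin n) λ j → Σ (Fin n) λ k → Σ (Fin n) λ l →
    (i < j) × (j < k) × (k < l) ×
    (π ⟨$⟩ʳ k < π ⟨$⟩ʳ l) × (π ⟨$⟩ʳ l < π ⟨$⟩ʳ i) × (π ⟨$⟩ʳ i < π ⟨$⟩ʳ j)

Avoids3412 : ∀ {n} → Perm n → Set
Avoids3412 π = ¬ Contains3412 π

IsInterval : ∀ {n} → Perm n → Fin n → Fin n → Set
IsInterval {n} π a b =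
  ∀ (i j : Fin n) → a ≤ i → i ≤ b → a ≤ j → j ≤ b →
  ∀ (v : Fin n) → π ⟨$⟩ʳ i ≤ v → v ≤ π ⟨$⟩ʳ j →
  Σ (Fin n) λ k → (a ≤ k) × (k ≤ b) × (π ⟨$⟩ʳ k ≡ v)

-- π is simple: its only intervals are ∅, singletons, and the whole [1,n]
-- (here 0-indexed: a = 0 and b = n-1).
IsSimple : ∀ {n} → Perm n → Set
IsSimple {n} π =
  ∀ (a b : Fin n) → a ≤ b → IsInterval π a b →
  (a ≡ b) ⊎ ((toℕ a ≡ 0) × (suc (toℕ b) ≡ n))

-- Let m = π(0). For 0 < x < m, a value π(x) > m would give the 3412
-- occurrence (0, x, m, π(x)), whose values are (m, π(x), 0, x). So the
-- involution π maps [0, m] into itself, which makes [0, m] an interval, and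
-- simplicity forces m to be 0 or n − 1. Either way the image of [1, n − 1]
-- is all values but an extreme one, so [1, n − 1] is a proper interval with
-- more than one point.
module Submission where

open import Defs
open import Data.Nat using (ℕ; suc; _>_; z≤n; s≤s)
import Data.Nat as ℕ
open import Data.Nat.Properties using (n≤0⇒n≡0; ≰⇒>)
open import Data.Fin using (Fin; toℕ; fromℕ; _≤_; _<_) renaming (zero to fzero; suc to fsuc)
open import Data.Fin.Properties
  using (toℕ-injective; _≟_; _≤?_; ≤-refl; ≤-trans; ≤-antisym; ≤∧≢⇒<; ≤fromℕ; toℕ≤pred[n])
open import Data.Fin.Permutation using (_⟨$⟩ʳ_; _⟨$⟩ˡ_; inverseʳ)
open import Data.Product using (_×_; _,_; proj₁; proj₂; map₂)
open import Data.Sum using (_⊎_; inj₁; inj₂)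
open import Function.Base using (_∘_)
open import Function.Bundles using (Injection)
open import Function.Properties.Inverse using (↔⇒↣)
open import Relation.Nullary using (¬_; yes; no; contradiction)
open import Relation.Binary.PropositionalEquality using (_≡_; _≢_; refl; sym; trans; cong; subst; subst₂)

IsExtremal : ∀ {n} → Fin n → Set
IsExtremal {n} v = toℕ v ≡ 0 ⊎ suc (toℕ v) ≡ n

extremal-between : ∀ {n} {x v y : Fin n} → IsExtremal v →
                   x ≤ v → v ≤ y → v ≡ x ⊎ v ≡ y
extremal-between {x = x} (inj₁ v≡0) x≤v _ =
  inj₁ (toℕ-injective (trans v≡0 (sym (n≤0⇒n≡0 (subst (toℕ x ℕ.≤_) v≡0 x≤v)))))
extremal-between {y = y} (inj₂ v≡last) _ v≤y =
  inj₂ (≤-antisym v≤y (subst (toℕ y ℕ.≤_) (sym (cong ℕ.pred v≡last)) (toℕ≤pred[n] y)))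

invariant-range⇒interval : ∀ {n} (π : Perm n) → IsInvolution π → {a b : Fin n} →
  (∀ x → a ≤ x → x ≤ b → a ≤ π ⟨$⟩ʳ x × π ⟨$⟩ʳ x ≤ b) →
  IsInterval π a b
invariant-range⇒interval π inv {a} {b} invariant i j a≤i i≤b a≤j j≤b v πi≤v v≤πj =
  π ⟨$⟩ʳ v , map₂ (_, inv v) (invariant v a≤v v≤b)
  where
  a≤v : a ≤ v
  a≤v = ≤-trans (proj₁ (invariant i a≤i i≤b)) πi≤v
  v≤b : v ≤ b
  v≤b = ≤-trans v≤πj (proj₂ (invariant j a≤j j≤b))

module _ {k : ℕ} (π : Perm (suc k)) (inv : IsInvolution π) where

  private
    m : Fin (suc k)
    m = π ⟨$⟩ʳ fzero

  3412-from-first-position : ∀ x → x ≢ fzero → x < m → m < π ⟨$⟩ʳ x → Contains3412 π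
  3412-from-first-position x x≢0 x<m m<πx =
    fzero , x , m , π ⟨$⟩ʳ x , 0<x , x<m , m<πx ,
    subst₂ _<_ (sym (inv fzero)) (sym (inv x)) 0<x ,
    subst (_< m) (sym (inv x)) x<m ,
    m<πx
    where
    0<x : 0 ℕ.< toℕ x
    0<x = ≤∧≢⇒< z≤n (x≢0 ∘ sym)

  avoids3412⇒initial-segment-invariant : Avoids3412 π → ∀ x → x ≤ m → π ⟨$⟩ʳ x ≤ m
  avoids3412⇒initial-segment-invariant avoids x x≤m with x ≟ fzero | x ≟ m
  ... | yes refl | _     = ≤-refl
  ... | no _     | yes refl = subst (_≤ m) (sym (inv fzero)) z≤n
  ... | no x≢0   | no x≢m with π ⟨$⟩ʳ x ≤? m
  ...   | yes πx≤m = πx≤m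
  ...   | no πx≰m  =
    contradiction (3412-from-first-position x x≢0 (≤∧≢⇒< x≤m x≢m) (≰⇒> πx≰m)) avoids

  first-value-extremal : IsSimple π → Avoids3412 π → IsExtremal m
  first-value-extremal simple avoids
    with simple fzero m z≤n (invariant-range⇒interval π inv
           λ x _ x≤m → z≤n , avoids3412⇒initial-segment-invariant avoids x x≤m)
  ... | inj₁ 0≡m          = inj₁ (sym (cong toℕ 0≡m))
  ... | inj₂ (_ , m≡last) = inj₂ m≡last

module _ {k : ℕ} (π : Perm (suc (suc k))) where

  private
    m : Fin (suc (suc k))
    m = π ⟨$⟩ʳ fzero

    one : Fin (suc (suc k))
    one = fsuc fzero

    only-first-position-maps-to-m : ∀ x → one ≤ x → m ≢ π ⟨$⟩ʳ x
    only-first-position-maps-to-m x 1≤x m≡πx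
      with Injection.injective (↔⇒↣ π) {fzero} {x} m≡πx
    only-first-position-maps-to-m _ () _ | refl

  tail-interval : IsExtremal m → IsInterval π one (fromℕ (suc k))
  tail-interval m-extremal i j 1≤i _ 1≤j _ v πi≤v v≤πj =
    π ⟨$⟩ˡ v , preimage-positive , ≤fromℕ (π ⟨$⟩ˡ v) , inverseʳ π
    where
    v≢m : v ≢ m
    v≢m refl with extremal-between m-extremal πi≤v v≤πj
    ... | inj₁ m≡πi = only-first-position-maps-to-m i 1≤i m≡πi
    ... | inj₂ m≡πj = only-first-position-maps-to-m j 1≤j m≡πj
    preimage-positive : one ≤ π ⟨$⟩ˡ v
    preimage-positive with π ⟨$⟩ˡ v in eq
    ... | fsuc _ = s≤s z≤n
    ... | fzero = contradiction (trans (sym (inverseʳ π {v})) (cong (π ⟨$⟩ʳ_) eq)) v≢m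

theorem5p3 : ∀ (n : ℕ) → n > 2 → (π : Perm n) →
    ¬ (IsInvolution π × IsSimple π × Avoids3412 π)
theorem5p3 (suc (suc (suc k))) (s≤s (s≤s (s≤s _))) π (inv , simple , avoids)
  with simple (fsuc fzero) (fromℕ (suc (suc k))) (s≤s z≤n)
         (tail-interval π (first-value-extremal π inv simple avoids))
... | inj₁ ()
... | inj₂ (() , _)
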